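{- Let $\alpha$ be a formula over a finite signature $\Sigma$ and let $v\in\mathcal I_c$ be a classical interpretation. Then $v$ is an equilibrium model of $\alpha$ if and only if $[\![\alpha]\!]\cap\{v\}\downarrow=\{v\}$.
   Context: $\Sigma$ is a finite set of atoms. Formulas are given by $\alpha ::= \bot \mid p \mid \alpha_1\wedge\alpha_2 \mid \alpha_1\vee\alpha_2 \mid \alpha_1\rightarrow\alpha_2$ with $p\in\Sigma$. A partial interpretation is a map $v:\Sigma\to\{0,1,2\}$; $\mathcal I$ is the set of all of them and $\mathcal I_c$ the set of classical ones (no atom mapped to $1$). The $G_3$ valuation extends $v$ to formulas: $v(\bot)=0$, $v(\alpha\wedge\beta)=\min(v(\alpha),v(\beta))$, $v(\alpha\vee\beta)=\max(v(\alpha),v(\beta))$, $v(\alpha\to\beta)=2$ if $v(\alpha)\le v(\beta)$ and $=v(\beta)$ otherwise; $v$ is a model of $\alpha$ iff $v(\alpha)=2$. The order on $\mathcal I$: $u\le v$ iff for every atom $p$, $u(p)\le v(p)$ and ($u(p)=0$ implies $v(p)=0$); $u<v$ means $u\le v$, $u\ne v$. A classical interpretation $v\in\mathcal I_c$ is an equilibrium model of $\alpha$ iff it is a $\le$-minimal model of $\alpha$. For $S\subseteq\mathcal I$: $\overline S=\mathcal I\setminus S$; $S_c=S\cap\mathcal I_c$; $S\downarrow=\{u\in\mathcal I:\exists v\in S,\ v\ge u\}$. The denotation: $[\![\bot]\!]=\emptyset$; $[\![p]\!]=\{v\in\mathcal I: v(p)=2\}$; $[\![\alpha\wedge\beta]\!]=[\![\alpha]\!]\cap[\![\beta]\!]$;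 $[\![\alpha\vee\beta]\!]=[\![\alpha]\!]\cup[\![\beta]\!]$; $[\![\alpha\to\beta]\!]=\big(\overline{[\![\alpha]\!]}\cup[\![\beta]\!]\big)\cap\big(\overline{[\![\alpha]\!]}\cup[\![\beta]\!]\big)_c\downarrow$. -}

module Defs where

open import Data.Nat using (ℕ)
open import Data.Fin using (Fin)
open import Data.Product using (Σ; _×_; ∃)
open import Data.Sum using (_⊎_)
open import Data.Empty using (⊥)
open import Relation.Nullary using (¬_)
open import Relation.Binary.PropositionalEquality using (_≡_)
open import Level using (0ℓ)

-- truth values of G3: 0 < 1 < 2
data V3 : Set where
  v0 v1 v2 : V3

data _≤3_ : V3 → V3 → Set where
  0≤x : ∀ {x} → v0 ≤3 x
  1≤1 : v1 ≤3 v1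
  1≤2 : v1 ≤3 v2
  2≤2 : v2 ≤3 v2

min3 : V3 → V3 → V3
min3 v0 _ = v0
min3 v1 v0 = v0
min3 v1 _ = v1
min3 v2 y = y

max3 : V3 → V3 → V3
max3 v0 y = y
max3 v1 v2 = v2
max3 v1 _ = v1
max3 v2 _ = v2

-- G3 implication: 2 if x ≤ y, else y
imp3 : V3 → V3 → V3
imp3 v0 _ = v2
imp3 v1 v0 = v0
imp3 v1 _ = v2
imp3 v2 y = y

data Form (n : ℕ) : Set where
  ⊥' : Form n
  atom : Fin n → Form n
  _∧'_ _∨'_ _⇒'_ : Form n → Form n → Form n

Interp : ℕ → Set
Interp n = Fin n → V3

Classical : ∀ {n} → Interp n → Set
Classical v = ∀ p → ¬ (v p ≡ v1)

val : ∀ {n} → Interp n → Form n → V3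
val v ⊥' = v0
val v (atom p) = v p
val v (a ∧' b) = min3 (val v a) (val v b)
val v (a ∨' b) = max3 (val v a) (val v b)
val v (a ⇒' b) = imp3 (val v a) (val v b)

Model : ∀ {n} → Interp n → Form n → Set
Model v α = val v α ≡ v2

_≼_ : ∀ {n} → Interp n → Interp n → Set
u ≼ v = ∀ p → (u p ≤3 v p) × (u p ≡ v0 → v p ≡ v0)

_≐_ : ∀ {n} → Interp n → Interp n → Set
u ≐ v = ∀ p → u p ≡ v p

EquilibriumModel : ∀ {n} → Interp n → Form n → Set
EquilibriumModel v α =
  Classical v × Model v α × (∀ u → Model u α → u ≼ v → u ≐ v)

ISet : ℕ → Set₁
ISet n = Interp n → Set

-- S ↓ = { u | ∃ v ∈ S, u ≤ v }  ; restricted to classical: (S_c)↓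
_c↓ : ∀ {n} → ISet n → ISet n
(S c↓) u = Σ _ λ w → S w × Classical w × u ≼ w

↓single : ∀ {n} → Interp n → ISet n
↓single v u = u ≼ v

⟦_⟧ : ∀ {n} → Form n → ISet n
⟦ ⊥' ⟧ u = ⊥
⟦ atom p ⟧ u = u p ≡ v2
⟦ a ∧' b ⟧ u = ⟦ a ⟧ u × ⟦ b ⟧ u
⟦ a ∨' b ⟧ u = ⟦ a ⟧ u ⊎ ⟦ b ⟧ u
⟦ a ⇒' b ⟧ u = (¬ ⟦ a ⟧ u ⊎ ⟦ b ⟧ u) × ((λ w → ¬ ⟦ a ⟧ w ⊎ ⟦ b ⟧ w) c↓) u

_≗ˢ_ : ∀ {n} → ISet n → ISet n → Set
S ≗ˢ T = ∀ u → (S u → T u) × (T u → S u)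

_∩_ : ∀ {n} → ISet n → ISet n → ISet n
(S ∩ T) u = S u × T u

single : ∀ {n} → Interp n → ISet n
single v u = u ≐ v

-- Read 2 as "true here", 1 as "true only there" and 0 as "false", and let `thereᴵ u`
-- forget the here-world of u.  Every connective of G3 commutes with this forgetting, and
-- thereᴵ u is the only classical interpretation above u; so a classical w ≥ u satisfies
-- a formula exactly when thereᴵ u does.  This lets the classical clause (·)_c↓ in the
-- denotation of an implication be evaluated at thereᴵ u, and then a case analysis on the
-- truth table of implication shows ⟦ α ⟧ = { u | val u α ≡ 2 }.  With that, both sides of
-- the theorem say that v is the only model of α below v.
module Submission where

open import Defs
open import Data.Nat using (ℕ)
open import Data.Product using (_×_; _,_; proj₁; proj₂)
open import Data.Product.Function.NonDependent.Propositional using (_×-⇔_)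
open import Data.Sum using (_⊎_; inj₁; inj₂)
open import Data.Sum.Function.Propositional using (_⊎-⇔_)
open import Data.Empty using (⊥-elim)
open import Function.Bundles using (_⇔_; mk⇔; Equivalence)
import Function.Properties.Equivalence as ⇔
open import Function.Related.Propositional using (module EquationalReasoning)
open import Function.Related.TypeIsomorphisms using (¬-cong-⇔)
open import Relation.Nullary using (¬_)
open import Relation.Binary.PropositionalEquality using (_≡_; refl; sym; trans; cong₂)

open Equivalence using (to; from)

private
  variable
    n : ℕ

there : V3 → V3
there v0 = v0
there v1 = v2
there v2 = v2

there-min3 : ∀ x y → there (min3 x y) ≡ min3 (there x) (there y)
there-min3 v0 y  = refl
there-min3 v1 v0 = refl
there-min3 v1 v1 = refl
there-min3 v1 v2 = refl
there-min3 v2 y  = refl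

there-max3 : ∀ x y → there (max3 x y) ≡ max3 (there x) (there y)
there-max3 v0 y  = refl
there-max3 v1 v0 = refl
there-max3 v1 v1 = refl
there-max3 v1 v2 = refl
there-max3 v2 v0 = refl
there-max3 v2 v1 = refl
there-max3 v2 v2 = refl

there-imp3 : ∀ x y → there (imp3 x y) ≡ imp3 (there x) (there y)
there-imp3 v0 y  = refl
there-imp3 v1 v0 = refl
there-imp3 v1 v1 = refl
there-imp3 v1 v2 = refl
there-imp3 v2 v0 = refl
there-imp3 v2 v1 = refl
there-imp3 v2 v2 = refl

thereᴵ : Interp n → Interp n
thereᴵ u p = there (u p)

thereᴵ-classical : (u : Interp n) → Classical (thereᴵ u)
thereᴵ-classical u p with u p
... | v0 = λ ()
... | v1 = λ ()
... | v2 = λ ()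

≼-thereᴵ : (u : Interp n) → u ≼ thereᴵ u
≼-thereᴵ u p with u p
... | v0 = 0≤x , λ _ → refl
... | v1 = 1≤2 , λ ()
... | v2 = 2≤2 , λ ()

classical-above-≐thereᴵ : {u w : Interp n} → u ≼ w → Classical w → w ≐ thereᴵ u
classical-above-≐thereᴵ {u = u} {w} u≼w w-cl p = go (u p) (w p) (u≼w p) (w-cl p)
  where
  go : ∀ x y → (x ≤3 y) × (x ≡ v0 → y ≡ v0) → ¬ y ≡ v1 → y ≡ there x
  go v0 y  (_ , x0⇒y0) _   = x0⇒y0 refl
  go v1 v1 _           y≢1 = ⊥-elim (y≢1 refl)
  go v1 v2 _           _   = refl
  go v2 v2 _           _   = refl

≐-refl : (u : Interp n) → u ≐ u
≐-refl u p = refl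

≐⇒≼ : {u w : Interp n} → u ≐ w → u ≼ w
≐⇒≼ {u = u} {w} u≐w p rewrite u≐w p = ≼-refl₃ (w p)
  where
  ≼-refl₃ : ∀ x → (x ≤3 x) × (x ≡ v0 → x ≡ v0)
  ≼-refl₃ v0 = 0≤x , λ e → e
  ≼-refl₃ v1 = 1≤1 , λ e → e
  ≼-refl₃ v2 = 2≤2 , λ e → e

val-cong : (α : Form n) {u w : Interp n} → u ≐ w → val u α ≡ val w α
val-cong ⊥'       u≐w = refl
val-cong (atom p) u≐w = u≐w p
val-cong (a ∧' b) u≐w = cong₂ min3 (val-cong a u≐w) (val-cong b u≐w)
val-cong (a ∨' b) u≐w = cong₂ max3 (val-cong a u≐w) (val-cong b u≐w)
val-cong (a ⇒' b) u≐w = cong₂ imp3 (val-cong a u≐w) (val-cong b u≐w)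

val-thereᴵ : (α : Form n) (u : Interp n) → val (thereᴵ u) α ≡ there (val u α)
val-thereᴵ ⊥'       u = refl
val-thereᴵ (atom p) u = refl
val-thereᴵ (a ∧' b) u =
  trans (cong₂ min3 (val-thereᴵ a u) (val-thereᴵ b u)) (sym (there-min3 (val u a) (val u b)))
val-thereᴵ (a ∨' b) u =
  trans (cong₂ max3 (val-thereᴵ a u) (val-thereᴵ b u)) (sym (there-max3 (val u a) (val u b)))
val-thereᴵ (a ⇒' b) u =
  trans (cong₂ imp3 (val-thereᴵ a u) (val-thereᴵ b u)) (sym (there-imp3 (val u a) (val u b)))

c↓-cong : {S T : ISet n} → (∀ w → S w ⇔ T w) → ∀ u → (S c↓) u ⇔ (T c↓) u
c↓-cong S⇔T u = mk⇔
  (λ (w , Sw , w-cl , u≼w) → w , to   (S⇔T w) Sw , w-cl , u≼w)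
  (λ (w , Tw , w-cl , u≼w) → w , from (S⇔T w) Tw , w-cl , u≼w)

c↓⇔thereᴵ : {S : ISet n} → (∀ {u w} → u ≐ w → S u → S w) → ∀ u → (S c↓) u ⇔ S (thereᴵ u)
c↓⇔thereᴵ S-resp u = mk⇔
  (λ (w , Sw , w-cl , u≼w) → S-resp (classical-above-≐thereᴵ u≼w w-cl) Sw)
  (λ S-there → thereᴵ u , S-there , thereᴵ-classical u , ≼-thereᴵ u)

min3≡v2⇔ : ∀ x y → min3 x y ≡ v2 ⇔ (x ≡ v2 × y ≡ v2)
min3≡v2⇔ x y = mk⇔ (⇒ x y) λ { (refl , refl) → refl }
  where
  ⇒ : ∀ x y → min3 x y ≡ v2 → x ≡ v2 × y ≡ v2
  ⇒ v1 v0 ()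
  ⇒ v1 v1 ()
  ⇒ v1 v2 ()
  ⇒ v2 v2 _ = refl , refl

max3≡v2⇔ : ∀ x y → max3 x y ≡ v2 ⇔ (x ≡ v2 ⊎ y ≡ v2)
max3≡v2⇔ x y = mk⇔ (⇒ x y) (⇐ x y)
  where
  ⇒ : ∀ x y → max3 x y ≡ v2 → x ≡ v2 ⊎ y ≡ v2
  ⇒ v0 v2 _ = inj₂ refl
  ⇒ v1 v2 _ = inj₂ refl
  ⇒ v2 y  _ = inj₁ refl
  ⇐ : ∀ x y → x ≡ v2 ⊎ y ≡ v2 → max3 x y ≡ v2
  ⇐ v2 y  _ = refl
  ⇐ v0 v2 _ = refl
  ⇐ v1 v2 _ = refl
  ⇐ v0 v0 (inj₁ ())
  ⇐ v0 v1 (inj₁ ())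
  ⇐ v1 v0 (inj₁ ())
  ⇐ v1 v1 (inj₁ ())

Implies : V3 → V3 → Set
Implies x y = ¬ x ≡ v2 ⊎ y ≡ v2

imp3≡v2⇔ : ∀ x y → imp3 x y ≡ v2 ⇔ (Implies x y × Implies (there x) (there y))
imp3≡v2⇔ x y = mk⇔ (⇒ x y) (⇐ x y)
  where
  ⇒ : ∀ x y → imp3 x y ≡ v2 → Implies x y × Implies (there x) (there y)
  ⇒ v0 y  _ = inj₁ (λ ()) , inj₁ (λ ())
  ⇒ v1 v1 _ = inj₁ (λ ()) , inj₂ refl
  ⇒ v1 v2 _ = inj₂ refl , inj₂ refl
  ⇒ v2 v2 _ = inj₂ refl , inj₂ refl
  ⇐ : ∀ x y → Implies x y × Implies (there x) (there y) → imp3 x y ≡ v2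
  ⇐ v0 y  _                  = refl
  ⇐ v1 v1 _                  = refl
  ⇐ v1 v2 _                  = refl
  ⇐ v2 v2 _                  = refl
  ⇐ v1 v0 (_ , inj₁ 2≢2)     = ⊥-elim (2≢2 refl)
  ⇐ v2 v0 (inj₁ 2≢2 , _)     = ⊥-elim (2≢2 refl)
  ⇐ v2 v1 (inj₁ 2≢2 , _)     = ⊥-elim (2≢2 refl)

⟦⟧⇔Model : (α : Form n) (u : Interp n) → ⟦ α ⟧ u ⇔ Model u α
⟦⟧⇔Model ⊥'       u = mk⇔ (λ ()) (λ ())
⟦⟧⇔Model (atom p) u = mk⇔ (λ e → e) (λ e → e)
⟦⟧⇔Model (a ∧' b) u = begin
  (⟦ a ⟧ u × ⟦ b ⟧ u)           ∼⟨ ⟦⟧⇔Model a u ×-⇔ ⟦⟧⇔Model b u ⟩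
  (Model u a × Model u b)       ∼⟨ ⇔.sym (min3≡v2⇔ (val u a) (val u b)) ⟩
  Model u (a ∧' b)              ∎
  where open EquationalReasoning
⟦⟧⇔Model (a ∨' b) u = begin
  (⟦ a ⟧ u ⊎ ⟦ b ⟧ u)           ∼⟨ ⟦⟧⇔Model a u ⊎-⇔ ⟦⟧⇔Model b u ⟩
  (Model u a ⊎ Model u b)       ∼⟨ ⇔.sym (max3≡v2⇔ (val u a) (val u b)) ⟩
  Model u (a ∨' b)              ∎
  where open EquationalReasoning
⟦⟧⇔Model (a ⇒' b) u = begin
  (Imp⟦⟧ u × (Imp⟦⟧ c↓) u)                             ∼⟨ Imp⟦⟧⇔ImpVal u ×-⇔ c↓-cong Imp⟦⟧⇔ImpVal u ⟩
  (ImpVal u × (ImpVal c↓) u)                            ∼⟨ ⇔.refl ×-⇔ c↓⇔thereᴵ ImpVal-resp u ⟩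
  (ImpVal u × ImpVal (thereᴵ u))                        ≡⟨ cong₂ (λ x y → ImpVal u × Implies x y)
                                                                 (val-thereᴵ a u) (val-thereᴵ b u) ⟩
  (Implies (val u a) (val u b) × Implies (there (val u a)) (there (val u b)))
                                                        ∼⟨ ⇔.sym (imp3≡v2⇔ (val u a) (val u b)) ⟩
  Model u (a ⇒' b)                                      ∎
  where
  open EquationalReasoning
  Imp⟦⟧ ImpVal : ISet _
  Imp⟦⟧ w = ¬ ⟦ a ⟧ w ⊎ ⟦ b ⟧ w
  ImpVal w = Implies (val w a) (val w b)
  Imp⟦⟧⇔ImpVal : ∀ w → Imp⟦⟧ w ⇔ ImpVal w
  Imp⟦⟧⇔ImpVal w = ¬-cong-⇔ (⟦⟧⇔Model a w) ⊎-⇔ ⟦⟧⇔Model b w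
  ImpVal-resp : ∀ {w w′} → w ≐ w′ → ImpVal w → ImpVal w′
  ImpVal-resp w≐w′ (inj₁ w⊭a) = inj₁ λ w′⊨a → w⊭a (trans (val-cong a w≐w′) w′⊨a)
  ImpVal-resp w≐w′ (inj₂ w⊨b) = inj₂ (trans (sym (val-cong b w≐w′)) w⊨b)

theorem6 : ∀ {n : ℕ} (α : Form n) (v : Interp n) → Classical v →
    (EquilibriumModel v α → (⟦ α ⟧ ∩ ↓single v) ≗ˢ single v) ×
    ((⟦ α ⟧ ∩ ↓single v) ≗ˢ single v → EquilibriumModel v α)
theorem6 α v v-cl = equilibrium⇒ , ⇒equilibrium
  where
  equilibrium⇒ : EquilibriumModel v α → (⟦ α ⟧ ∩ ↓single v) ≗ˢ single v
  equilibrium⇒ (_ , v⊨α , minimal) u =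
    (λ (u∈⟦α⟧ , u≼v) → minimal u (to (⟦⟧⇔Model α u) u∈⟦α⟧) u≼v) ,
    (λ u≐v → from (⟦⟧⇔Model α u) (trans (val-cong α u≐v) v⊨α) , ≐⇒≼ u≐v)
  ⇒equilibrium : (⟦ α ⟧ ∩ ↓single v) ≗ˢ single v → EquilibriumModel v α
  ⇒equilibrium ⟦α⟧↓v≗v =
    v-cl ,
    to (⟦⟧⇔Model α v) (proj₁ (proj₂ (⟦α⟧↓v≗v v) (≐-refl v))) ,
    λ u u⊨α u≼v → proj₁ (⟦α⟧↓v≗v u) (from (⟦⟧⇔Model α u) u⊨α , u≼v)
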